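{- For every positive integer $n$, $S(n) \subseteq \{0,1,\ldots,\lfloor (n-2)/3\rfloor\}$.
   Context: $n \bmod k$ denotes the least nonnegative remainder of $n$ upon division by $k$. $S(n) := \{ n \bmod k : k \in \{1,2,\ldots,\lfloor n/2\rfloor\}\}$. -}

module Defs where

open import Data.Nat using (ℕ; suc; _≤_; _/_; _%_)
open import Data.Product using (Σ; _×_)
open import Relation.Binary.PropositionalEquality using (_≡_)

-- m ∈ S(n)  iff  m = n mod k for some k with 1 ≤ k ≤ ⌊n/2⌋.
-- k is written as suc j (so k ≥ 1 and the divisor is NonZero).
InS : ℕ → ℕ → Set
InS n m = Σ ℕ λ j → (suc j ≤ n / 2) × (n % suc j ≡ m)

{-# OPTIONS --safe #-}
-- If 1 ≤ k ≤ n/2, the quotient of n by k is at least 2, so writing n = qk + r with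
-- r < k gives n ≥ 2k + r ≥ 2(r + 1) + r = 3r + 2, that is r ≤ (n − 2)/3.
module Submission where

open import Defs
open import Data.Nat using (ℕ; suc; _≤_; _∸_; _/_; _%_; _+_; _*_; NonZero)
open import Data.Nat.Properties
  using (≤-trans; *-comm; *-monoˡ-≤; *-monoʳ-≤; +-monoʳ-≤; m+n≤o⇒m≤o∸n; module ≤-Reasoning)
open import Data.Nat.DivMod using (m≡m%n+[m/n]*n; m%n<n; m*n/n≡m; m/n*n≤m; /-monoˡ-≤)
open import Data.Nat.Tactic.RingSolver using (solve-∀)
open import Data.Product using (_,_)
open import Relation.Binary.PropositionalEquality using (_≡_; refl; subst)

m*n≤o⇒m≤o/n : ∀ m n {o} .{{_ : NonZero n}} → m * n ≤ o → m ≤ o / n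
m*n≤o⇒m≤o/n m n {o} m*n≤o = begin
  m         ≡⟨ m*n/n≡m m n ⟨
  m * n / n ≤⟨ /-monoˡ-≤ n m*n≤o ⟩
  o / n     ∎
  where open ≤-Reasoning

m≤n/o⇒m*o≤n : ∀ {m} n o .{{_ : NonZero o}} → m ≤ n / o → m * o ≤ n
m≤n/o⇒m*o≤n n o m≤n/o = ≤-trans (*-monoˡ-≤ o m≤n/o) (m/n*n≤m n o)

m%n+o*n≤m : ∀ m n {o} .{{_ : NonZero n}} → o ≤ m / n → m % n + o * n ≤ m
m%n+o*n≤m m n {o} o≤m/n = begin
  m % n + o * n     ≤⟨ +-monoʳ-≤ (m % n) (*-monoˡ-≤ n o≤m/n) ⟩
  m % n + m / n * n ≡⟨ m≡m%n+[m/n]*n m n ⟨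
  m                 ∎
  where open ≤-Reasoning

2≤m/n⇒m%n*3+2≤m : ∀ m n .{{_ : NonZero n}} → 2 ≤ m / n → m % n * 3 + 2 ≤ m
2≤m/n⇒m%n*3+2≤m m n 2≤m/n = begin
  m % n * 3 + 2           ≡⟨ regroup (m % n) ⟩
  m % n + 2 * suc (m % n) ≤⟨ +-monoʳ-≤ (m % n) (*-monoʳ-≤ 2 (m%n<n m n)) ⟩
  m % n + 2 * n           ≤⟨ m%n+o*n≤m m n 2≤m/n ⟩
  m                       ∎
  where
  open ≤-Reasoning
  regroup : ∀ r → r * 3 + 2 ≡ r + 2 * suc r
  regroup = solve-∀

lemma2p5 : (n : ℕ) → 1 ≤ n → (m : ℕ) → InS n m → m ≤ (n ∸ 2) / 3
lemma2p5 n _ _ (j , k≤n/2 , refl) =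
  m*n≤o⇒m≤o/n (n % k) 3 (m+n≤o⇒m≤o∸n (n % k * 3) (2≤m/n⇒m%n*3+2≤m n k 2≤n/k))
  where
  k : ℕ
  k = suc j
  2≤n/k : 2 ≤ n / k
  2≤n/k = m*n≤o⇒m≤o/n 2 k (subst (_≤ n) (*-comm k 2) (m≤n/o⇒m*o≤n n 2 k≤n/2))
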